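{- Consider the real-time tree-buffer algorithm described in the context, run on a valid sequence of $\mathrm{initialize}(x_0)$ followed by $\ell$ modifying operations. For every $k\le\ell$: (a) $R^{(k)}\subseteq M_k$; (b) if $M_k\setminus R^{(k)}\ne\emptyset$, then the queue of the algorithm is nonempty after the first $k$ modifying operations.
   Context: Fix an integer $h\ge1$. Reference semantics: a valid sequence is $\mathrm{initialize}(x_0)$ followed by modifying operations $\mathrm{add\_child}(x,y)$ or $\mathrm{deactivate}(x)$ on a rooted tree $T$ and set $\mathrm{Active}\subseteq T$: initialize creates the tree $\{x_0\}$ (root $x_0$) with Active $=\{x_0\}$; $\mathrm{add\_child}(x,y)$ requires $x\in$ Active and $y$ fresh, and adds $y$ to $T$ as a child of $x$ and to Active; $\mathrm{deactivate}(x)$ removes $x$ from Active (nodes never leave $T$). $T^{(k)}$, $\mathrm{Active}^{(k)}$ denote these after the first $k$ modifying operations. The subtree of $x$ is $x$ and its descendants; the depth of $x$ is its distance to the root in $T$; $\mathrm{level}(x)=\lfloor\mathrm{depth}(x)/h\rfloor$. A node $x$ is recent if some active node $y$ in its subtree has $\mathrm{level}(x)\ge\mathrm{level}(y)-1$; $R^{(k)}$ is the set of recent nodes of $T^{(k)}$ w.r.t. $\mathrm{Active}^{(k)}$. Real-time algorithm: each allocated node stores fields parent (a node or nil), children, depth, rep, cnt; the algorithm keeps Active and a FIFO queue. $\mathrm{initialize}(x)$: allocate $x$, Active$:=\{x\}$, parent$(x)$:=nil, children$(x):=0$, depth$(x):=0$, rep$(x):=x$, cnt$(x):=1$. $\mathrm{cut\_parent}(y)$: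 let $x:=$parent$(y)$; if $x\ne$ nil, decrement children$(x)$ and, if then children$(x)=0$ and $x\notin$ Active, enqueue $x$; set parent$(y)$:=nil. $\mathrm{process\_queue}()$: if the queue is nonempty, dequeue $x$, call $\mathrm{cut\_parent}(x)$, delete $x$ from memory. $\mathrm{add\_child}(x,y)$: allocate $y$, add $y$ to Active, parent$(y):=x$, increment children$(x)$, children$(y):=0$, cnt$(y):=0$, depth$(y)$:=depth$(x)+1$, rep$(y):=y$ if depth$(y)\equiv0\pmod h$ else rep$(x)$, increment cnt(rep$(y)$), then call $\mathrm{process\_queue}()$. $\mathrm{deactivate}(x)$: remove $x$ from Active, decrement cnt(rep$(x)$); if children$(x)=0$ enqueue $x$; if cnt(rep$(x)$)$=0$ call $\mathrm{cut\_parent}$(rep$(x)$); then call $\mathrm{process\_queue}()$. $M_k$ is the set of nodes allocated and not yet deleted after the first $k$ modifying operations. -}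

module Defs where

open import Data.Nat using (ℕ; zero; suc; _+_; _∸_; _≤_; _≡ᵇ_; NonZero)
open import Data.Nat.DivMod using (_/_; _%_)
open import Data.Bool using (Bool; true; false; if_then_else_; not; _∧_)
open import Data.Maybe using (Maybe; just; nothing)
open import Data.List using (List; []; _∷_; _++_; [_])
open import Data.Unit using (⊤)
open import Data.Product using (Σ; _×_; ∃)
open import Relation.Binary.PropositionalEquality using (_≡_)

upd : {A : Set} → (ℕ → A) → ℕ → A → ℕ → A
upd f k v z = if z ≡ᵇ k then v else f z

data Op : Set where
  addChild   : ℕ → ℕ → Op
  deactivate : ℕ → Op

record RefState : Set where
  field
    inT : ℕ → Bool
    par : ℕ → Maybe ℕ       -- parent in T (nothing for the root / non-members)
    act : ℕ → Bool
open RefState public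

refInit : ℕ → RefState
refInit x0 = record { inT = λ z → z ≡ᵇ x0 ; par = λ _ → nothing ; act = λ z → z ≡ᵇ x0 }

refStep : RefState → Op → RefState
refStep r (addChild x y) = record
  { inT = upd (inT r) y true ; par = upd (par r) y (just x) ; act = upd (act r) y true }
refStep r (deactivate x) = record r { act = upd (act r) x false }

refRun : RefState → List Op → RefState
refRun r []       = r
refRun r (o ∷ os) = refRun (refStep r o) os

ValidOp : RefState → Op → Set
ValidOp r (addChild x y) = (act r x ≡ true) × (inT r y ≡ false)
ValidOp r (deactivate x) = act r x ≡ true

Valid : RefState → List Op → Set
Valid r []       = ⊤
Valid r (o ∷ os) = ValidOp r o × Valid (refStep r o) os

-- Ancestor-or-self relation in the tree: Anc r x y means y is in the subtree of x.
data Anc (r : RefState) (x : ℕ) : ℕ → Set where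
  anc-refl : Anc r x x
  anc-step : ∀ {y z} → par r y ≡ just z → Anc r x z → Anc r x y

data Depth (r : RefState) : ℕ → ℕ → Set where
  depth-root : ∀ {x} → par r x ≡ nothing → Depth r x 0
  depth-step : ∀ {x z d} → par r x ≡ just z → Depth r z d → Depth r x (suc d)

-- level(x) = ⌊ depth(x) / h ⌋ ; recent nodes
-- x is recent iff x ∈ T and some active y in the subtree of x has
-- level(x) ≥ level(y) - 1, i.e. level(y) ≤ level(x) + 1.
Recent : (h : ℕ) → .{{_ : NonZero h}} → RefState → ℕ → Set
Recent h r x =
  (inT r x ≡ true) ×
  ∃ λ y → (act r y ≡ true) × Anc r x y ×
    ∃ λ dx → ∃ λ dy → Depth r x dx × Depth r y dy × (dy / h ≤ suc (dx / h))

record AlgState : Set where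
  field
    alloc    : ℕ → Bool         -- allocated and not yet deleted (the set M)
    parent   : ℕ → Maybe ℕ
    children : ℕ → ℕ
    depth    : ℕ → ℕ
    rep      : ℕ → ℕ
    cnt      : ℕ → ℕ
    active   : ℕ → Bool
    queue    : List ℕ           -- FIFO: dequeue from the front, enqueue at the back
open AlgState public

algInit : ℕ → AlgState
algInit x = record
  { alloc = λ z → z ≡ᵇ x ; parent = λ _ → nothing ; children = λ _ → 0
  ; depth = λ _ → 0 ; rep = upd (λ z → z) x x ; cnt = upd (λ _ → 0) x 1
  ; active = λ z → z ≡ᵇ x ; queue = [] }

enqueue : ℕ → AlgState → AlgState
enqueue x s = record s { queue = queue s ++ [ x ] }

cutParent : ℕ → AlgState → AlgState
cutParent y s with parent s y
... | nothing = record s { parent = upd (parent s) y nothing }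
... | just x  =
  let s1 = record s { children = upd (children s) x (children s x ∸ 1) }
      s2 = if (children s1 x ≡ᵇ 0) ∧ not (active s1 x) then enqueue x s1 else s1
  in record s2 { parent = upd (parent s2) y nothing }

processQueue : AlgState → AlgState
processQueue s with queue s
... | []     = s
... | x ∷ q  =
  let s1 = cutParent x (record s { queue = q })
  in record s1 { alloc = upd (alloc s1) x false }

algAddChild : (h : ℕ) → .{{_ : NonZero h}} → ℕ → ℕ → AlgState → AlgState
algAddChild h x y s =
  let s1 = record s
             { alloc = upd (alloc s) y true
             ; active = upd (active s) y true
             ; parent = upd (parent s) y (just x) }
      s2 = record s1 { children = upd (children s1) x (suc (children s1 x)) }
      s3 = record s2 { children = upd (children s2) y 0
                     ; cnt = upd (cnt s2) y 0
                     ; depth = upd (depth s2) y (suc (depth s2 x)) }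
      s4 = record s3 { rep = upd (rep s3) y
                         (if depth s3 y % h ≡ᵇ 0 then y else rep s3 x) }
      s5 = record s4 { cnt = upd (cnt s4) (rep s4 y) (suc (cnt s4 (rep s4 y))) }
  in processQueue s5

algDeactivate : ℕ → AlgState → AlgState
algDeactivate x s =
  let s1 = record s { active = upd (active s) x false }
      s2 = record s1 { cnt = upd (cnt s1) (rep s1 x) (cnt s1 (rep s1 x) ∸ 1) }
      s3 = if children s2 x ≡ᵇ 0 then enqueue x s2 else s2
      s4 = if cnt s3 (rep s3 x) ≡ᵇ 0 then cutParent (rep s3 x) s3 else s3
  in processQueue s4

algStep : (h : ℕ) → .{{_ : NonZero h}} → AlgState → Op → AlgState
algStep h s (addChild x y) = algAddChild h x y s
algStep h s (deactivate x) = algDeactivate x s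

algRun : (h : ℕ) → .{{_ : NonZero h}} → AlgState → List Op → AlgState
algRun h s []       = s
algRun h s (o ∷ os) = algRun h (algStep h s o) os

-- Each operation preserves an invariant coupling the algorithm's state to the reference tree:
-- allocated nodes lie in T; depth, rep, children and cnt hold their intended values; an edge
-- c → p of T is kept while p is recent through c (some active node below c has level at most
-- level p + 1); deleted and queued nodes are not recent; allocated, inactive, childless nodes are
-- queued; and a block root still attached to its parent has positive cnt.  The algorithm only cuts
-- an edge c → p through which p is not recent: c is either a dequeued non-recent node or a block
-- root whose cnt dropped to 0.  Part (a) is a field of the invariant, and part (b) follows from it
-- by a descent along children of the same level.

module Submission where

open import Defs
open import Data.Bool using (Bool; true; false; not; _∧_; if_then_else_; T)
open import Data.Bool.Properties using (∧-zeroʳ)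
open import Data.Empty using (⊥)
open import Data.List using (List; []; _∷_; _++_; [_]; take; length)
open import Data.List.Membership.Propositional using (_∈_)
open import Data.List.Membership.Propositional.Properties using (∈-++⁺ˡ; ∈-++⁺ʳ; ∈-++⁻)
open import Data.List.Relation.Unary.All as All using ([])
open import Data.List.Relation.Unary.Any using (here; there)
open import Data.List.Relation.Unary.Unique.Propositional using (Unique; []; _∷_)
open import Data.Maybe using (Maybe; just; nothing)
open import Data.Maybe.Properties using (just-injective; ≡-dec)
open import Data.Nat using (ℕ; zero; suc; _+_; _*_; _∸_; _≤_; _<_; _≡ᵇ_; NonZero; >-nonZero⁻¹; z≤n; s≤s)
open import Data.Nat.Divisibility using (divides-refl)
open import Data.Nat.DivMod
open import Data.Nat.Properties
open import Data.Product using (∃; _×_; _,_; proj₁; proj₂)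
open import Data.Sum using (_⊎_; inj₁; inj₂)
open import Data.Unit using (tt)
open import Function using (_∘_)
open import Relation.Nullary using (¬_; Dec; yes; no; contradiction)
open import Relation.Binary.PropositionalEquality hiding ([_])

≡ᵇ-refl : ∀ n → (n ≡ᵇ n) ≡ true
≡ᵇ-refl zero    = refl
≡ᵇ-refl (suc n) = ≡ᵇ-refl n

≡ᵇ-true⇒≡ : ∀ {m n} → (m ≡ᵇ n) ≡ true → m ≡ n
≡ᵇ-true⇒≡ {m} {n} eq = ≡ᵇ⇒≡ m n (subst T (sym eq) tt)

≢⇒≡ᵇ-false : ∀ {m n} → m ≢ n → (m ≡ᵇ n) ≡ false
≢⇒≡ᵇ-false {m} {n} m≢n with m ≡ᵇ n in eq
... | false = refl
... | true  = contradiction (≡ᵇ-true⇒≡ eq) m≢n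

upd-≡ : ∀ {A : Set} (f : ℕ → A) k v → upd f k v k ≡ v
upd-≡ f k v rewrite ≡ᵇ-refl k = refl

upd-≢ : ∀ {A : Set} (f : ℕ → A) k v {z} → z ≢ k → upd f k v z ≡ f z
upd-≢ f k v z≢k rewrite ≢⇒≡ᵇ-false z≢k = refl

∧≡true⇒ : ∀ {a b} → a ∧ b ≡ true → a ≡ true × b ≡ true
∧≡true⇒ {true} {true} _ = refl , refl

upd-false≡true : ∀ (f : ℕ → Bool) k z → upd f k false z ≡ true → f z ≡ true × z ≢ k
upd-false≡true f k z eq with z ≟ k
... | yes refl = contradiction (trans (sym (upd-≡ f k false)) eq) (λ ())
... | no z≢k   = trans (sym (upd-≢ f k false z≢k)) eq , z≢k

module Levels (h : ℕ) .{{_ : NonZero h}} where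

  /-digits : ∀ {r} q → r < h → (r + q * h) / h ≡ q
  /-digits {r} q r<h = begin
    (r + q * h) / h   ≡⟨ +-distrib-/-∣ʳ r (divides-refl q) ⟩
    r / h + q * h / h ≡⟨ cong₂ _+_ (m<n⇒m/n≡0 r<h) (m*n/n≡m q h) ⟩
    q                 ∎
    where open ≡-Reasoning

  %-digits : ∀ {r} q → r < h → (r + q * h) % h ≡ r
  %-digits {r} q r<h = trans ([m+kn]%n≡m%n r q h) (m<n⇒m%n≡m r<h)

  private
    suc-digits : ∀ n → suc n ≡ suc (n % h) + n / h * h
    suc-digits n = cong suc (m≡m%n+[m/n]*n n h)

    suc-rem≡h : ∀ n → ¬ suc (n % h) < h → suc (n % h) ≡ h
    suc-rem≡h n ≮h = ≤-antisym (m%n<n n h) (≮⇒≥ ≮h)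

  level-suc-boundary : ∀ n → suc n % h ≡ 0 → suc n / h ≡ suc (n / h)
  level-suc-boundary n ≡0 with suc (n % h) <? h
  ... | yes <h = contradiction (trans (sym (%-digits (n / h) <h)) (trans (cong (_% h) (sym (suc-digits n))) ≡0)) 1+n≢0
  ... | no ≮h = begin
    suc n / h                   ≡⟨ /-congˡ (trans (suc-digits n) (cong (_+ n / h * h) (suc-rem≡h n ≮h))) ⟩
    (0 + suc (n / h) * h) / h   ≡⟨ /-digits (suc (n / h)) (>-nonZero⁻¹ h) ⟩
    suc (n / h)                 ∎
    where open ≡-Reasoning

  level-suc-interior : ∀ n → suc n % h ≢ 0 → suc n / h ≡ n / h
  level-suc-interior n ≢0 with suc (n % h) <? h
  ... | yes <h = trans (/-congˡ (suc-digits n)) (/-digits (n / h) <h)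
  ... | no ≮h = contradiction (begin
    suc n % h                   ≡⟨ cong (_% h) (trans (suc-digits n) (cong (_+ n / h * h) (suc-rem≡h n ≮h))) ⟩
    (0 + suc (n / h) * h) % h   ≡⟨ %-digits (suc (n / h)) (>-nonZero⁻¹ h) ⟩
    0                           ∎) ≢0
    where open ≡-Reasoning

  block-start-unique : ∀ {a b} → a % h ≡ 0 → b % h ≡ 0 → a / h ≡ b / h → a ≡ b
  block-start-unique {a} {b} a%h≡0 b%h≡0 same-level = begin
    a                 ≡⟨ m≡m%n+[m/n]*n a h ⟩
    a % h + a / h * h ≡⟨ cong₂ (λ r q → r + q * h) (trans a%h≡0 (sym b%h≡0)) same-level ⟩
    b % h + b / h * h ≡⟨ m≡m%n+[m/n]*n b h ⟨
    b                 ∎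
    where open ≡-Reasoning

module Tree (r : RefState) where

  Depth-functional : ∀ {z d d′} → Depth r z d → Depth r z d′ → d ≡ d′
  Depth-functional (depth-root _)    (depth-root _)     = refl
  Depth-functional (depth-root e)    (depth-step e′ _)  with () ← trans (sym e) e′
  Depth-functional (depth-step e _)  (depth-root e′)    with () ← trans (sym e) e′
  Depth-functional (depth-step e dz) (depth-step e′ dz′) with refl ← just-injective (trans (sym e) e′) =
    cong suc (Depth-functional dz dz′)

  Depth-parent : ∀ {z p d} → par r z ≡ just p → Depth r z d → ∃ λ d′ → d ≡ suc d′ × Depth r p d′
  Depth-parent e (depth-root e′) with () ← trans (sym e) e′
  Depth-parent e (depth-step {d = d′} e′ dp) with refl ← just-injective (trans (sym e) e′) = d′ , refl , dp

  Anc-trans : ∀ {a b c} → Anc r a b → Anc r b c → Anc r a c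
  Anc-trans ab anc-refl        = ab
  Anc-trans ab (anc-step e bz) = anc-step e (Anc-trans ab bz)

  Anc⇒≡⊎depth-< : ∀ {a b da db} → Anc r a b → Depth r a da → Depth r b db → a ≡ b ⊎ da < db
  Anc⇒≡⊎depth-< anc-refl        _  _  = inj₁ refl
  Anc⇒≡⊎depth-< (anc-step e az) da db with d′ , refl , dz ← Depth-parent e db with Anc⇒≡⊎depth-< az da dz
  ... | inj₁ refl = inj₂ (≤-reflexive (cong suc (Depth-functional da dz)))
  ... | inj₂ lt   = inj₂ (m<n⇒m<1+n lt)

  Anc⇒depth-≤ : ∀ {a b da db} → Anc r a b → Depth r a da → Depth r b db → da ≤ db
  Anc⇒depth-≤ ab da db with Anc⇒≡⊎depth-< ab da db
  ... | inj₁ refl = ≤-reflexive (Depth-functional da db)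
  ... | inj₂ lt   = <⇒≤ lt

  Anc-linear : ∀ {a b w} → Anc r a w → Anc r b w → Anc r a b ⊎ Anc r b a
  Anc-linear anc-refl        bw                = inj₂ bw
  Anc-linear (anc-step e az) anc-refl          = inj₁ (anc-step e az)
  Anc-linear (anc-step e az) (anc-step e′ bz′) with refl ← just-injective (trans (sym e) e′) = Anc-linear az bz′

  Anc-depth-injective : ∀ {a b d} → Anc r a b → Depth r a d → Depth r b d → a ≡ b
  Anc-depth-injective ab da db with Anc⇒≡⊎depth-< ab da db
  ... | inj₁ a≡b = a≡b
  ... | inj₂ d<d = contradiction d<d (<-irrefl refl)

  Anc-same-depth⇒≡ : ∀ {a b w d} → Anc r a w → Anc r b w → Depth r a d → Depth r b d → a ≡ b
  Anc-same-depth⇒≡ aw bw da db with Anc-linear aw bw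
  ... | inj₁ ab = Anc-depth-injective ab da db
  ... | inj₂ ba = sym (Anc-depth-injective ba db da)

  Anc⇒child-on-path : ∀ {x w} → Anc r x w → w ≢ x → ∃ λ c → par r c ≡ just x × Anc r c w
  Anc⇒child-on-path anc-refl w≢x = contradiction refl w≢x
  Anc⇒child-on-path {x} (anc-step {y} {z} e xz) _ with z ≟ x
  ... | yes refl = y , e , anc-refl
  ... | no z≢x with c , ec , cz ← Anc⇒child-on-path xz z≢x = c , ec , anc-step e cz

  Anc-parent : ∀ {c y x} → Anc r c y → par r y ≡ just x → c ≢ y → Anc r c x
  Anc-parent anc-refl         _ c≢y = contradiction refl c≢y
  Anc-parent (anc-step e′ cz) e _   with refl ← just-injective (trans (sym e) e′) = cz

module Transfer (r r′ : RefState)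
  (edge⇒inT : ∀ z p → par r z ≡ just p → inT r z ≡ true × inT r p ≡ true)
  (same-par : ∀ z → inT r z ≡ true → par r′ z ≡ par r z) where

  Anc⁺ : ∀ {a b} → Anc r a b → Anc r′ a b
  Anc⁺ anc-refl = anc-refl
  Anc⁺ {b = b} (anc-step {z = z} e az) = anc-step (trans (same-par b (proj₁ (edge⇒inT b z e))) e) (Anc⁺ az)

  Anc⁻ : ∀ {a b} → Anc r′ a b → inT r b ≡ true → Anc r a b
  Anc⁻ anc-refl _ = anc-refl
  Anc⁻ {b = b} (anc-step {z = z} e′ az) ib =
    let e = trans (sym (same-par b ib)) e′ in anc-step e (Anc⁻ az (proj₂ (edge⇒inT b z e)))

  Depth⁺ : ∀ {z d} → Depth r z d → inT r z ≡ true → Depth r′ z d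
  Depth⁺ {z} (depth-root e) iz = depth-root (trans (same-par z iz) e)
  Depth⁺ {z} (depth-step {z = p} e dp) iz = depth-step (trans (same-par z iz) e) (Depth⁺ dp (proj₂ (edge⇒inT z p e)))

  Depth⁻ : ∀ {z d} → Depth r′ z d → inT r z ≡ true → Depth r z d
  Depth⁻ {z} (depth-root e′) iz = depth-root (trans (sym (same-par z iz)) e′)
  Depth⁻ {z} (depth-step {z = p} e′ dp) iz =
    let e = trans (sym (same-par z iz)) e′ in depth-step e (Depth⁻ dp (proj₂ (edge⇒inT z p e)))

countᵇ : (ℕ → Bool) → List ℕ → ℕ
countᵇ f []      = 0
countᵇ f (z ∷ L) = if f z then suc (countᵇ f L) else countᵇ f L

module _ (f : ℕ → Bool) where

  countᵇ-≡0 : ∀ L → (∀ c → c ∈ L → f c ≡ false) → countᵇ f L ≡ 0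
  countᵇ-≡0 []      _     = refl
  countᵇ-≡0 (z ∷ L) all-false rewrite all-false z (here refl) = countᵇ-≡0 L (λ c m → all-false c (there m))

  countᵇ-≢0 : ∀ L {c} → c ∈ L → f c ≡ true → countᵇ f L ≢ 0
  countᵇ-≢0 (z ∷ L) (here refl) fc rewrite fc = λ ()
  countᵇ-≢0 (z ∷ L) (there m)   fc with f z
  ... | true  = λ ()
  ... | false = countᵇ-≢0 L m fc

  countᵇ-witness : ∀ L → countᵇ f L ≢ 0 → ∃ λ c → c ∈ L × f c ≡ true
  countᵇ-witness []      ≢0 = contradiction refl ≢0
  countᵇ-witness (z ∷ L) ≢0 with f z in fz
  ... | true  = z , here refl , fz
  ... | false with c , m , fc ← countᵇ-witness L ≢0 = c , there m , fc

countᵇ-cong : ∀ f g L → (∀ c → c ∈ L → f c ≡ g c) → countᵇ f L ≡ countᵇ g L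
countᵇ-cong f g []      _  = refl
countᵇ-cong f g (z ∷ L) eq rewrite eq z (here refl) | countᵇ-cong f g L (λ c m → eq c (there m)) = refl

countᵇ-drop-one : ∀ f g L {x} → Unique L → x ∈ L → f x ≡ true → g x ≡ false →
  (∀ c → c ≢ x → f c ≡ g c) → countᵇ f L ≡ suc (countᵇ g L)
countᵇ-drop-one f g (z ∷ L) (z∉L ∷ _) (here refl) fx gx eq rewrite fx | gx =
  cong suc (countᵇ-cong f g L (λ c m → eq c (λ { refl → All.lookup z∉L m refl })))
countᵇ-drop-one f g (z ∷ L) {x} (z∉L ∷ uL) (there m) fx gx eq with z ≟ x
... | yes refl = contradiction refl (All.lookup z∉L m)
... | no z≢x rewrite eq z z≢x with g z
...   | true  = cong suc (countᵇ-drop-one f g L uL m fx gx eq)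
...   | false = countᵇ-drop-one f g L uL m fx gx eq

record CutSpec (y : ℕ) (s s′ : AlgState) : Set where
  field
    cut-alloc          : ∀ z → alloc s′ z ≡ alloc s z
    cut-active         : ∀ z → active s′ z ≡ active s z
    cut-depth          : ∀ z → depth s′ z ≡ depth s z
    cut-rep            : ∀ z → rep s′ z ≡ rep s z
    cut-cnt            : ∀ z → cnt s′ z ≡ cnt s z
    cut-parent-self    : parent s′ y ≡ nothing
    cut-parent-other   : ∀ z → z ≢ y → parent s′ z ≡ parent s z
    cut-children-self  : ∀ x → parent s y ≡ just x → children s′ x ≡ children s x ∸ 1
    cut-children-other : ∀ z → parent s y ≢ just z → children s′ z ≡ children s z
    cut-queue-⊇        : ∀ q → q ∈ queue s → q ∈ queue s′
    cut-queue-new      : ∀ q → q ∈ queue s′ →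
                           q ∈ queue s ⊎ (parent s y ≡ just q × children s′ q ≡ 0 × active s q ≡ false)
    cut-enqueues       : ∀ x → parent s y ≡ just x → children s′ x ≡ 0 → active s x ≡ false → x ∈ queue s′

cutParent-spec : ∀ y s → CutSpec y s (cutParent y s)
cutParent-spec y s with parent s y in py
... | nothing = record
  { cut-alloc = λ _ → refl ; cut-active = λ _ → refl ; cut-depth = λ _ → refl
  ; cut-rep = λ _ → refl ; cut-cnt = λ _ → refl
  ; cut-parent-self = upd-≡ (parent s) y nothing
  ; cut-parent-other = λ z → upd-≢ (parent s) y nothing
  ; cut-children-self = λ x e → contradiction (trans (sym py) e) (λ ())
  ; cut-children-other = λ _ _ → refl
  ; cut-queue-⊇ = λ _ m → m
  ; cut-queue-new = λ _ m → inj₁ m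
  ; cut-enqueues = λ x e → contradiction (trans (sym py) e) (λ ()) }
... | just x = by-emptiness
  where
  s₁ : AlgState
  s₁ = record s { children = upd (children s) x (children s x ∸ 1) }

  children-self : ∀ x′ → parent s y ≡ just x′ → children s₁ x′ ≡ children s x′ ∸ 1
  children-self x′ e with refl ← just-injective (trans (sym py) e) = upd-≡ (children s) x _

  children-other : ∀ z → parent s y ≢ just z → children s₁ z ≡ children s z
  children-other z y↛z = upd-≢ (children s) x _ (λ { refl → y↛z py })

  by-emptiness : CutSpec y s (let s₂ = if (children s₁ x ≡ᵇ 0) ∧ not (active s₁ x) then enqueue x s₁ else s₁
                              in record s₂ { parent = upd (parent s₂) y nothing })
  by-emptiness with (children s₁ x ≡ᵇ 0) ∧ not (active s₁ x) in emptied
  ... | true = record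
    { cut-alloc = λ _ → refl ; cut-active = λ _ → refl ; cut-depth = λ _ → refl
    ; cut-rep = λ _ → refl ; cut-cnt = λ _ → refl
    ; cut-parent-self = upd-≡ (parent s) y nothing
    ; cut-parent-other = λ z → upd-≢ (parent s) y nothing
    ; cut-children-self = children-self
    ; cut-children-other = children-other
    ; cut-queue-⊇ = λ _ → ∈-++⁺ˡ
    ; cut-queue-new = λ q m → queue-new q (∈-++⁻ (queue s) m)
    ; cut-enqueues = λ x′ e _ _ → subst (_∈ queue s ++ [ x ]) (just-injective (trans (sym py) e)) (∈-++⁺ʳ (queue s) (here refl)) }
    where
    queue-new : ∀ q → q ∈ queue s ⊎ q ∈ [ x ] →
      q ∈ queue s ⊎ (parent s y ≡ just q × children s₁ q ≡ 0 × active s q ≡ false)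
    queue-new q (inj₁ m) = inj₁ m
    queue-new q (inj₂ (here refl)) with children s₁ x ≡ᵇ 0 in e | active s x
    queue-new q (inj₂ (here refl)) | true | false = inj₂ (py , ≡ᵇ-true⇒≡ e , refl)
  ... | false = record
    { cut-alloc = λ _ → refl ; cut-active = λ _ → refl ; cut-depth = λ _ → refl
    ; cut-rep = λ _ → refl ; cut-cnt = λ _ → refl
    ; cut-parent-self = upd-≡ (parent s) y nothing
    ; cut-parent-other = λ z → upd-≢ (parent s) y nothing
    ; cut-children-self = children-self
    ; cut-children-other = children-other
    ; cut-queue-⊇ = λ _ m → m
    ; cut-queue-new = λ _ m → inj₁ m
    ; cut-enqueues = not-emptied }
    where
    not-emptied : ∀ x′ → parent s y ≡ just x′ → children s₁ x′ ≡ 0 → active s x′ ≡ false → x′ ∈ queue s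
    not-emptied x′ e c≡0 inactive with refl ← just-injective (trans (sym py) e) =
      contradiction (trans (sym emptied) (cong₂ (λ c a → (c ≡ᵇ 0) ∧ not a) c≡0 inactive)) (λ ())

_≟ᵐ_ : (a b : Maybe ℕ) → Dec (a ≡ b)
_≟ᵐ_ = ≡-dec _≟_

isParentOf : Maybe ℕ → ℕ → Bool
isParentOf nothing  _ = false
isParentOf (just p) x = p ≡ᵇ x

isParentOf-true : ∀ m x → isParentOf m x ≡ true → m ≡ just x
isParentOf-true (just p) x e = cong just (≡ᵇ-true⇒≡ e)

isParentOf-false : ∀ m x → m ≢ just x → isParentOf m x ≡ false
isParentOf-false nothing  x _   = refl
isParentOf-false (just p) x p≢x = ≢⇒≡ᵇ-false (λ p≡x → p≢x (cong just p≡x))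

isParentOf-just : ∀ x → isParentOf (just x) x ≡ true
isParentOf-just = ≡ᵇ-refl

record DeactivateSpec (x : ℕ) (s s′ : AlgState) : Set where
  field
    deact-alloc     : ∀ z → alloc s′ z ≡ alloc s z
    deact-active    : ∀ z → active s′ z ≡ upd (active s) x false z
    deact-depth     : ∀ z → depth s′ z ≡ depth s z
    deact-rep       : ∀ z → rep s′ z ≡ rep s z
    deact-cnt       : ∀ z → cnt s′ z ≡ upd (cnt s) (rep s x) (cnt s (rep s x) ∸ 1) z
    deact-parent    : ∀ z → parent s′ z ≡ parent s z
    deact-children  : ∀ z → children s′ z ≡ children s z
    deact-queue-⊇   : ∀ q → q ∈ queue s → q ∈ queue s′
    deact-queue-new : ∀ q → q ∈ queue s′ → q ∈ queue s ⊎ (q ≡ x × children s x ≡ 0)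
    deact-enqueues  : children s x ≡ 0 → x ∈ queue s′

markInactive : ℕ → AlgState → AlgState
markInactive x s =
  let s₁ = record s { active = upd (active s) x false }
  in record s₁ { cnt = upd (cnt s₁) (rep s₁ x) (cnt s₁ (rep s₁ x) ∸ 1) }

markInactive-spec : ∀ x s b → (children s x ≡ᵇ 0) ≡ b →
  DeactivateSpec x s (if b then enqueue x (markInactive x s) else markInactive x s)
markInactive-spec x s true childless = record
  { deact-alloc = λ _ → refl ; deact-active = λ _ → refl ; deact-depth = λ _ → refl
  ; deact-rep = λ _ → refl ; deact-cnt = λ _ → refl ; deact-parent = λ _ → refl ; deact-children = λ _ → refl
  ; deact-queue-⊇ = λ _ → ∈-++⁺ˡ
  ; deact-queue-new = λ q m → queue-new q (∈-++⁻ (queue s) m)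
  ; deact-enqueues = λ _ → ∈-++⁺ʳ (queue s) (here refl) }
  where
  queue-new : ∀ q → q ∈ queue s ⊎ q ∈ [ x ] → q ∈ queue s ⊎ (q ≡ x × children s x ≡ 0)
  queue-new q (inj₁ m)           = inj₁ m
  queue-new q (inj₂ (here refl)) = inj₂ (refl , ≡ᵇ-true⇒≡ childless)
markInactive-spec x s false has-children = record
  { deact-alloc = λ _ → refl ; deact-active = λ _ → refl ; deact-depth = λ _ → refl
  ; deact-rep = λ _ → refl ; deact-cnt = λ _ → refl ; deact-parent = λ _ → refl ; deact-children = λ _ → refl
  ; deact-queue-⊇ = λ _ m → m
  ; deact-queue-new = λ _ m → inj₁ m
  ; deact-enqueues = λ childless → contradiction (trans (sym has-children) (cong (_≡ᵇ 0) childless)) (λ ()) }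

Valid-take : ∀ {r} k ops → Valid r ops → Valid r (take k ops)
Valid-take zero    ops       _                 = tt
Valid-take (suc k) []        _                 = tt
Valid-take (suc k) (o ∷ ops) (valid-o , valid) = valid-o , Valid-take k ops valid

module Invariants (h : ℕ) .{{_ : NonZero h}} where
  open Levels h

  record RecentThrough (r : RefState) (s : AlgState) (z c : ℕ) : Set where
    constructor through
    field
      {witness}      : ℕ
      witness-active : act r witness ≡ true
      witness-below  : Anc r c witness
      witness-level  : depth s witness / h ≤ suc (depth s z / h)

  RecentThrough-depth : ∀ {r s s′ z c} → (∀ x → depth s′ x ≡ depth s x) →
    RecentThrough r s′ z c → RecentThrough r s z c
  RecentThrough-depth {z = z} same (through {w} aw cw lw) =
    through aw cw (subst₂ (λ a b → a / h ≤ suc (b / h)) (same w) (same z) lw)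

  Detachable : RefState → AlgState → ℕ → Set
  Detachable r s y = ∀ p → par r y ≡ just p → ¬ RecentThrough r s p y

  BlockRootOf : RefState → AlgState → ℕ → ℕ → Set
  BlockRootOf r s b z = Anc r b z × depth s b % h ≡ 0 × depth s b / h ≡ depth s z / h × inT r b ≡ true

  BlockRootOf-depth : ∀ {r s s′ b z} → (∀ x → depth s′ x ≡ depth s x) → BlockRootOf r s b z → BlockRootOf r s′ b z
  BlockRootOf-depth {b = b} {z} same (bz , b%h , lb , ib) =
    bz , trans (cong (_% h) (same b)) b%h , trans (cong (_/ h) (same b)) (trans lb (cong (_/ h) (sym (same z)))) , ib

  -- L enumerates T so that children and cnt can be specified as counts; depth<size bounds
  -- the descent in part (b).
  record Coupled (r : RefState) (L : List ℕ) (s : AlgState) : Set where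
    field
      nodes⇒inT        : ∀ z → z ∈ L → inT r z ≡ true
      inT⇒nodes        : ∀ z → inT r z ≡ true → z ∈ L
      nodes-unique     : Unique L
      act⇒inT          : ∀ z → act r z ≡ true → inT r z ≡ true
      edge⇒inT         : ∀ z p → par r z ≡ just p → inT r z ≡ true × inT r p ≡ true
      depth-correct    : ∀ z → inT r z ≡ true → Depth r z (depth s z)
      depth<size       : ∀ z → inT r z ≡ true → depth s z < length L
      alloc⇒inT        : ∀ z → alloc s z ≡ true → inT r z ≡ true
      active≡act       : ∀ z → active s z ≡ act r z
      parent⇒edge      : ∀ z p → parent s z ≡ just p → par r z ≡ just p × alloc s z ≡ true
      children≡count   : ∀ x → children s x ≡ countᵇ (λ c → isParentOf (parent s c) x) L
      rep-block-root   : ∀ z → inT r z ≡ true → BlockRootOf r s (rep s z) z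
      cnt≡count        : ∀ b → cnt s b ≡ countᵇ (λ c → active s c ∧ (rep s c ≡ᵇ b)) L
      recent-edge-kept : ∀ c p → par r c ≡ just p → RecentThrough r s p c → parent s c ≡ just p
      unalloc⇒¬Recent  : ∀ z → inT r z ≡ true → alloc s z ≡ false → ¬ Recent h r z

  QueueSound : RefState → AlgState → Set
  QueueSound r s = ∀ q → q ∈ queue s → inT r q ≡ true × ¬ Recent h r q

  BlockCounted : AlgState → ℕ → Set
  BlockCounted s z = depth s z % h ≡ 0 → parent s z ≢ nothing → cnt s z ≢ 0

  GarbageQueued : AlgState → ℕ → Set
  GarbageQueued s z = alloc s z ≡ true → active s z ≡ false → children s z ≡ 0 → z ∈ queue s

  record Invariant (r : RefState) (L : List ℕ) (s : AlgState) : Set where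
    field
      coupled        : Coupled r L s
      queue-sound    : QueueSound r s
      block-counted  : ∀ z → BlockCounted s z
      garbage-queued : ∀ z → GarbageQueued s z

  module _ {r L s} (I : Coupled r L s) where
    open Coupled I
    open Tree r

    Recent⇒RecentThrough : ∀ {z} → Recent h r z → RecentThrough r s z z
    Recent⇒RecentThrough (iz , w , aw , zw , dz , dw , Dz , Dw , lw) =
      through aw zw (subst₂ (λ a b → b / h ≤ suc (a / h))
                       (Depth-functional Dz (depth-correct _ iz)) (Depth-functional Dw (depth-correct w (act⇒inT w aw))) lw)

    RecentThrough⇒Recent : ∀ {z} → inT r z ≡ true → RecentThrough r s z z → Recent h r z
    RecentThrough⇒Recent {z} iz (through {w} aw zw lw) =
      iz , w , aw , zw , depth s z , depth s w , depth-correct z iz , depth-correct w (act⇒inT w aw) , lw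

    depth-child : ∀ {c p} → par r c ≡ just p → depth s c ≡ suc (depth s p)
    depth-child {c} {p} e with ic , ip ← edge⇒inT c p e with d′ , eq , dp ← Depth-parent e (depth-correct c ic) =
      trans eq (cong suc (Depth-functional dp (depth-correct p ip)))

    level-child : ∀ {c p} → par r c ≡ just p → depth s c % h ≡ 0 → depth s c / h ≡ suc (depth s p / h)
    level-child {c} {p} e c%h = trans (cong (_/ h) (depth-child e))
                                      (level-suc-boundary (depth s p) (trans (cong (_% h) (sym (depth-child e))) c%h))

    -- A witness of recency below x lies below some child c, and the edge c → x is then kept.
    childless-inactive⇒¬Recent : ∀ {x} → act r x ≡ false → children s x ≡ 0 → ¬ Recent h r x
    childless-inactive⇒¬Recent {x} inactive childless rec with Recent⇒RecentThrough rec
    ... | through {w} aw xw lw with w ≟ x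
    ...   | yes refl = contradiction (trans (sym inactive) aw) (λ ())
    ...   | no w≢x with c , c→x , cw ← Anc⇒child-on-path xw w≢x =
      countᵇ-≢0 (λ c → isParentOf (parent s c) x) L (inT⇒nodes c (proj₁ (edge⇒inT c x c→x)))
        (subst (λ m → isParentOf m x ≡ true) (sym (recent-edge-kept c x c→x (through aw cw lw))) (isParentOf-just x))
        (trans (sym (children≡count x)) childless)

    rep-of-block-member : ∀ {b w} → inT r b ≡ true → depth s b % h ≡ 0 → Anc r b w → inT r w ≡ true →
      depth s w / h ≡ depth s b / h → rep s w ≡ b
    rep-of-block-member {b} {w} ib b%h bw iw lw with rw , rw%h , lrw , irw ← rep-block-root w iw =
      Anc-same-depth⇒≡ rw bw (depth-correct _ irw) (subst (Depth r b) (sym same-depth) (depth-correct b ib))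
      where
      same-depth : depth s (rep s w) ≡ depth s b
      same-depth = block-start-unique rw%h b%h (trans lrw lw)

    -- Every active node through which the parent of a block root b is recent lies in the block of b.
    uncounted-block-detachable : ∀ {b} → inT r b ≡ true → depth s b % h ≡ 0 → cnt s b ≡ 0 → Detachable r s b
    uncounted-block-detachable {b} ib b%h uncounted p b→p (through {w} aw bw lw) =
      countᵇ-≢0 (λ c → active s c ∧ (rep s c ≡ᵇ b)) L (inT⇒nodes w iw) counted (trans (sym (cnt≡count b)) uncounted)
      where
      iw : inT r w ≡ true
      iw = act⇒inT w aw
      same-level : depth s w / h ≡ depth s b / h
      same-level = ≤-antisym (subst (depth s w / h ≤_) (sym (level-child b→p b%h)) lw)
                             (/-monoˡ-≤ h (Anc⇒depth-≤ bw (depth-correct b ib) (depth-correct w iw)))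
      counted : (active s w ∧ (rep s w ≡ᵇ b)) ≡ true
      counted rewrite active≡act w | aw | rep-of-block-member ib b%h bw iw same-level = ≡ᵇ-refl b

  module Cut {r L s s′ y} (I : Coupled r L s) (spec : CutSpec y s s′) (detachable : Detachable r s y) where
    open Coupled I
    open CutSpec spec

    children≡count′ : ∀ x → children s′ x ≡ countᵇ (λ c → isParentOf (parent s′ c) x) L
    children≡count′ x with parent s y ≟ᵐ just x
    ... | yes y↦x = begin
      children s′ x                                    ≡⟨ cut-children-self x y↦x ⟩
      children s x ∸ 1                                 ≡⟨ cong (_∸ 1) (children≡count x) ⟩
      countᵇ (λ c → isParentOf (parent s c) x) L ∸ 1   ≡⟨ cong (_∸ 1) (countᵇ-drop-one _ _ L nodes-unique y∈L
                                                            (subst (λ m → isParentOf m x ≡ true) (sym y↦x) (isParentOf-just x))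
                                                            (cong (λ m → isParentOf m x) cut-parent-self)
                                                            (λ c c≢y → cong (λ m → isParentOf m x) (sym (cut-parent-other c c≢y)))) ⟩
      countᵇ (λ c → isParentOf (parent s′ c) x) L      ∎
      where
      open ≡-Reasoning
      y∈L : y ∈ L
      y∈L = inT⇒nodes y (proj₁ (edge⇒inT y x (proj₁ (parent⇒edge y x y↦x))))
    ... | no y↛x = trans (cut-children-other x y↛x) (trans (children≡count x) (countᵇ-cong _ _ L same))
      where
      same : ∀ c → c ∈ L → isParentOf (parent s c) x ≡ isParentOf (parent s′ c) x
      same c _ with c ≟ y
      ... | yes refl = trans (isParentOf-false _ x y↛x) (cong (λ m → isParentOf m x) (sym cut-parent-self))
      ... | no c≢y   = cong (λ m → isParentOf m x) (sym (cut-parent-other c c≢y))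

    recent-edge-kept′ : ∀ c p → par r c ≡ just p → RecentThrough r s′ p c → parent s′ c ≡ just p
    recent-edge-kept′ c p e rec with c ≟ y
    ... | yes refl = contradiction (RecentThrough-depth cut-depth rec) (detachable p e)
    ... | no c≢y   = trans (cut-parent-other c c≢y) (recent-edge-kept c p e (RecentThrough-depth cut-depth rec))

    parent⇒edge′ : ∀ z p → parent s′ z ≡ just p → par r z ≡ just p × alloc s′ z ≡ true
    parent⇒edge′ z p e with z ≟ y
    ... | yes refl = contradiction (trans (sym cut-parent-self) e) (λ ())
    ... | no z≢y with z→p , az ← parent⇒edge z p (trans (sym (cut-parent-other z z≢y)) e) =
      z→p , trans (cut-alloc z) az

    coupled′ : Coupled r L s′
    coupled′ = record
      { nodes⇒inT = nodes⇒inT ; inT⇒nodes = inT⇒nodes ; nodes-unique = nodes-unique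
      ; act⇒inT = act⇒inT ; edge⇒inT = edge⇒inT
      ; depth-correct = λ z iz → subst (Depth r z) (sym (cut-depth z)) (depth-correct z iz)
      ; depth<size = λ z iz → subst (_< length L) (sym (cut-depth z)) (depth<size z iz)
      ; alloc⇒inT = λ z e → alloc⇒inT z (trans (sym (cut-alloc z)) e)
      ; active≡act = λ z → trans (cut-active z) (active≡act z)
      ; parent⇒edge = parent⇒edge′
      ; children≡count = children≡count′
      ; rep-block-root = λ z iz → subst (λ b → BlockRootOf r s′ b z) (sym (cut-rep z))
                                   (BlockRootOf-depth {r} {s} {s′} cut-depth (rep-block-root z iz))
      ; cnt≡count = λ b → trans (cut-cnt b) (trans (cnt≡count b) (countᵇ-cong _ _ L
                      (λ c _ → cong₂ (λ a t → a ∧ (t ≡ᵇ b)) (sym (cut-active c)) (sym (cut-rep c)))))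
      ; recent-edge-kept = recent-edge-kept′
      ; unalloc⇒¬Recent = λ z iz e → unalloc⇒¬Recent z iz (trans (sym (cut-alloc z)) e)
      }

    queue-sound′ : QueueSound r s → QueueSound r s′
    queue-sound′ sound q m with cut-queue-new q m
    ... | inj₁ m′ = sound q m′
    ... | inj₂ (y↦q , childless , inactive) =
      proj₂ (edge⇒inT y q (proj₁ (parent⇒edge y q y↦q))) ,
      childless-inactive⇒¬Recent coupled′ (trans (sym (active≡act q)) inactive) childless

    block-counted′ : ∀ z → (z ≢ y → BlockCounted s z) → BlockCounted s′ z
    block-counted′ z counted z%h attached with z ≟ y
    ... | yes refl = contradiction cut-parent-self attached
    ... | no z≢y = subst (_≢ 0) (sym (cut-cnt z))
                     (counted z≢y (trans (cong (_% h) (sym (cut-depth z))) z%h)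
                                  (λ e → attached (trans (cut-parent-other z z≢y) e)))

    garbage-queued′ : ∀ z → GarbageQueued s z → GarbageQueued s′ z
    garbage-queued′ z queued az inactive childless with parent s y ≟ᵐ just z
    ... | yes y↦z = cut-enqueues z y↦z childless (trans (sym (cut-active z)) inactive)
    ... | no y↛z = cut-queue-⊇ z (queued (trans (sym (cut-alloc z)) az) (trans (sym (cut-active z)) inactive)
                                        (trans (sym (cut-children-other z y↛z)) childless))

  Coupled-requeue : ∀ {r L s} qs → Coupled r L s → Coupled r L (record s { queue = qs })
  Coupled-requeue qs I = record
    { nodes⇒inT = nodes⇒inT ; inT⇒nodes = inT⇒nodes ; nodes-unique = nodes-unique
    ; act⇒inT = act⇒inT ; edge⇒inT = edge⇒inT ; depth-correct = depth-correct ; depth<size = depth<size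
    ; alloc⇒inT = alloc⇒inT ; active≡act = active≡act ; parent⇒edge = parent⇒edge
    ; children≡count = children≡count ; rep-block-root = rep-block-root ; cnt≡count = cnt≡count
    ; recent-edge-kept = λ c p e → recent-edge-kept c p e ∘ RecentThrough-depth (λ _ → refl)
    ; unalloc⇒¬Recent = unalloc⇒¬Recent
    }
    where open Coupled I

  Coupled-delete : ∀ {r L s q} → Coupled r L s → parent s q ≡ nothing → ¬ Recent h r q →
    Coupled r L (record s { alloc = upd (alloc s) q false })
  Coupled-delete {r} {L} {s} {q} I detached q¬recent = record
    { nodes⇒inT = nodes⇒inT ; inT⇒nodes = inT⇒nodes ; nodes-unique = nodes-unique
    ; act⇒inT = act⇒inT ; edge⇒inT = edge⇒inT ; depth-correct = depth-correct ; depth<size = depth<size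
    ; alloc⇒inT = alloc⇒inT′ ; active≡act = active≡act ; parent⇒edge = parent⇒edge′
    ; children≡count = children≡count ; rep-block-root = rep-block-root ; cnt≡count = cnt≡count
    ; recent-edge-kept = λ c p e → recent-edge-kept c p e ∘ RecentThrough-depth (λ _ → refl)
    ; unalloc⇒¬Recent = unalloc⇒¬Recent′
    }
    where
    open Coupled I
    alloc⇒inT′ : ∀ z → upd (alloc s) q false z ≡ true → inT r z ≡ true
    alloc⇒inT′ z e with z ≟ q
    ... | yes refl = contradiction (trans (sym (upd-≡ (alloc s) q false)) e) (λ ())
    ... | no z≢q   = alloc⇒inT z (trans (sym (upd-≢ (alloc s) q false z≢q)) e)
    parent⇒edge′ : ∀ z p → parent s z ≡ just p → par r z ≡ just p × upd (alloc s) q false z ≡ true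
    parent⇒edge′ z p e with z ≟ q
    ... | yes refl = contradiction (trans (sym detached) e) (λ ())
    ... | no z≢q with z→p , az ← parent⇒edge z p e = z→p , trans (upd-≢ (alloc s) q false z≢q) az
    unalloc⇒¬Recent′ : ∀ z → inT r z ≡ true → upd (alloc s) q false z ≡ false → ¬ Recent h r z
    unalloc⇒¬Recent′ z iz e with z ≟ q
    ... | yes refl = q¬recent
    ... | no z≢q   = unalloc⇒¬Recent z iz (trans (sym (upd-≢ (alloc s) q false z≢q)) e)

  processQueue-nil : ∀ s → queue s ≡ [] → processQueue s ≡ s
  processQueue-nil s e with queue s
  processQueue-nil s refl | [] = refl

  processQueue-cons : ∀ s {q qs} → queue s ≡ q ∷ qs →
    processQueue s ≡ (let s′ = cutParent q (record s { queue = qs }) in record s′ { alloc = upd (alloc s′) q false })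
  processQueue-cons s e with queue s
  processQueue-cons s refl | _ = refl

  processQueue-preserves : ∀ {r L s} → Invariant r L s → Invariant r L (processQueue s)
  processQueue-preserves {r} {L} {s} inv = by-queue (queue s) refl
    where
    open Invariant inv
    open Coupled coupled

    by-queue : ∀ Q → queue s ≡ Q → Invariant r L (processQueue s)
    by-queue [] eq = subst (Invariant r L) (sym (processQueue-nil s eq)) inv
    by-queue (q ∷ qs) eq = subst (Invariant r L) (sym (processQueue-cons s eq)) (record
      { coupled = Coupled-delete C.coupled′ (CutSpec.cut-parent-self (cutParent-spec q s₀)) q¬recent
      ; queue-sound = C.queue-sound′ (λ q′ m → queue-sound q′ (tail⊆queue m))
      ; block-counted = λ z → C.block-counted′ z (λ _ → block-counted z)
      ; garbage-queued = garbage-queued″ })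
      where
      s₀ s₁ : AlgState
      s₀ = record s { queue = qs }
      s₁ = cutParent q s₀

      tail⊆queue : ∀ {q′} → q′ ∈ qs → q′ ∈ queue s
      tail⊆queue m = subst (_ ∈_) (sym eq) (there m)

      iq : inT r q ≡ true
      iq = proj₁ (queue-sound q (subst (q ∈_) (sym eq) (here refl)))

      q¬recent : ¬ Recent h r q
      q¬recent = proj₂ (queue-sound q (subst (q ∈_) (sym eq) (here refl)))

      -- level p ≤ level q, so p recent through q would make q recent.
      detachable : Detachable r s₀ q
      detachable p q→p (through aw qw lw) = q¬recent (RecentThrough⇒Recent coupled iq (through aw qw
        (≤-trans lw (s≤s (/-monoˡ-≤ h (≤-trans (n≤1+n _) (≤-reflexive (sym (depth-child coupled q→p)))))))))

      module C = Cut (Coupled-requeue qs coupled) (cutParent-spec q s₀) detachable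

      garbage-queued″ : ∀ z → GarbageQueued (record s₁ { alloc = upd (alloc s₁) q false }) z
      garbage-queued″ z az with z ≟ q
      ... | yes refl = contradiction (trans (sym (upd-≡ (alloc s₁) q false)) az) (λ ())
      ... | no z≢q = C.garbage-queued′ z queued₀ (trans (sym (upd-≢ (alloc s₁) q false z≢q)) az)
        where
        queued₀ : GarbageQueued s₀ z
        queued₀ az₀ inactive childless with subst (z ∈_) eq (garbage-queued z az₀ inactive childless)
        ... | here z≡q = contradiction z≡q z≢q
        ... | there m  = m

  module Deactivate {r L s x s₃} (inv : Invariant r L s) (ax : act r x ≡ true) (spec : DeactivateSpec x s s₃) where
    open Invariant inv
    open Coupled coupled
    open DeactivateSpec spec

    r′ : RefState
    r′ = refStep r (deactivate x)

    module T = Transfer r r′ edge⇒inT (λ _ _ → refl)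

    ix : inT r x ≡ true
    ix = act⇒inT x ax

    act′⇒act : ∀ {w} → act r′ w ≡ true → act r w ≡ true
    act′⇒act {w} = proj₁ ∘ upd-false≡true (act r) x w

    Recent′⇒Recent : ∀ {z} → Recent h r′ z → Recent h r z
    Recent′⇒Recent (iz , w , aw , zw , dz , dw , Dz , Dw , lw) =
      iz , w , act′⇒act aw , T.Anc⁻ zw iw , dz , dw , T.Depth⁻ Dz iz , T.Depth⁻ Dw iw , lw
      where iw = act⇒inT w (act′⇒act aw)

    cnt≡count₃ : ∀ b → cnt s₃ b ≡ countᵇ (λ c → active s₃ c ∧ (rep s₃ c ≡ᵇ b)) L
    cnt≡count₃ b = trans (by-root b) (countᵇ-cong _ _ L (λ c _ → cong₂ (λ a t → a ∧ (t ≡ᵇ b)) (sym (deact-active c)) (sym (deact-rep c))))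
      where
      counts : ℕ → ℕ → Bool
      counts b c = upd (active s) x false c ∧ (rep s c ≡ᵇ b)
      by-root : ∀ b → cnt s₃ b ≡ countᵇ (counts b) L
      by-root b with b ≟ rep s x
      ... | yes refl = begin
        cnt s₃ b                                         ≡⟨ trans (deact-cnt b) (upd-≡ (cnt s) b _) ⟩
        cnt s b ∸ 1                                      ≡⟨ cong (_∸ 1) (cnt≡count b) ⟩
        countᵇ (λ c → active s c ∧ (rep s c ≡ᵇ b)) L ∸ 1 ≡⟨ cong (_∸ 1) (countᵇ-drop-one _ (counts b) L nodes-unique
                                                              (inT⇒nodes x ix)
                                                              (cong₂ _∧_ (trans (active≡act x) ax) (≡ᵇ-refl b))
                                                              (cong (_∧ (b ≡ᵇ b)) (upd-≡ (active s) x false))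
                                                              (λ c c≢x → cong (_∧ (rep s c ≡ᵇ b)) (sym (upd-≢ (active s) x false c≢x)))) ⟩
        countᵇ (counts b) L                              ∎
        where open ≡-Reasoning
      ... | no b≢rx = trans (deact-cnt b) (trans (upd-≢ (cnt s) _ _ b≢rx) (trans (cnt≡count b) (countᵇ-cong _ _ L same)))
        where
        same : ∀ c → c ∈ L → (active s c ∧ (rep s c ≡ᵇ b)) ≡ counts b c
        same c _ with c ≟ x
        ... | yes refl = begin
          active s x ∧ (rep s x ≡ᵇ b)             ≡⟨ cong (active s x ∧_) (≢⇒≡ᵇ-false (λ rx≡b → b≢rx (sym rx≡b))) ⟩
          active s x ∧ false                      ≡⟨ ∧-zeroʳ _ ⟩
          false                                   ≡⟨ cong (_∧ (rep s x ≡ᵇ b)) (upd-≡ (active s) x false) ⟨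
          counts b x                              ∎
          where open ≡-Reasoning
        ... | no c≢x = cong (_∧ (rep s c ≡ᵇ b)) (sym (upd-≢ (active s) x false c≢x))

    coupled₃ : Coupled r′ L s₃
    coupled₃ = record
      { nodes⇒inT = nodes⇒inT ; inT⇒nodes = inT⇒nodes ; nodes-unique = nodes-unique
      ; act⇒inT = λ z → act⇒inT z ∘ act′⇒act
      ; edge⇒inT = edge⇒inT
      ; depth-correct = λ z iz → subst (Depth r′ z) (sym (deact-depth z)) (T.Depth⁺ (depth-correct z iz) iz)
      ; depth<size = λ z iz → subst (_< length L) (sym (deact-depth z)) (depth<size z iz)
      ; alloc⇒inT = λ z e → alloc⇒inT z (trans (sym (deact-alloc z)) e)
      ; active≡act = λ z → trans (deact-active z) (cong (λ b → if z ≡ᵇ x then false else b) (active≡act z))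
      ; parent⇒edge = λ z p e → let z→p , az = parent⇒edge z p (trans (sym (deact-parent z)) e) in z→p , trans (deact-alloc z) az
      ; children≡count = λ y → trans (deact-children y) (trans (children≡count y)
                           (countᵇ-cong _ _ L (λ c _ → cong (λ m → isParentOf m y) (sym (deact-parent c)))))
      ; rep-block-root = rep-block-root₃
      ; cnt≡count = cnt≡count₃
      ; recent-edge-kept = λ c p e (through aw′ cw lw) → trans (deact-parent c)
          (recent-edge-kept c p e (RecentThrough-depth {s′ = s₃} deact-depth (through (act′⇒act aw′) (T.Anc⁻ cw (act⇒inT _ (act′⇒act aw′))) lw)))
      ; unalloc⇒¬Recent = λ z iz e → unalloc⇒¬Recent z iz (trans (sym (deact-alloc z)) e) ∘ Recent′⇒Recent
      }
      where
      rep-block-root₃ : ∀ z → inT r′ z ≡ true → BlockRootOf r′ s₃ (rep s₃ z) z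
      rep-block-root₃ z iz with bz , rest ← BlockRootOf-depth {r} {s} {s₃} deact-depth (rep-block-root z iz) =
        subst (λ b → BlockRootOf r′ s₃ b z) (sym (deact-rep z)) (T.Anc⁺ bz , rest)

    queue-sound₃ : QueueSound r′ s₃
    queue-sound₃ q m with deact-queue-new q m
    ... | inj₁ m′ = proj₁ (queue-sound q m′) , proj₂ (queue-sound q m′) ∘ Recent′⇒Recent
    ... | inj₂ (refl , childless) =
      ix , childless-inactive⇒¬Recent coupled₃ (upd-≡ (act r) x false) (trans (deact-children x) childless)

    garbage-queued₃ : ∀ z → GarbageQueued s₃ z
    garbage-queued₃ z az inactive childless with z ≟ x
    ... | yes refl = deact-enqueues (trans (sym (deact-children x)) childless)
    ... | no z≢x = deact-queue-⊇ z (garbage-queued z (trans (sym (deact-alloc z)) az)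
                     (trans (sym (upd-≢ (active s) x false z≢x)) (trans (sym (deact-active z)) inactive))
                     (trans (sym (deact-children z)) childless))

    block-counted₃ : ∀ z → z ≢ rep s₃ x → BlockCounted s₃ z
    block-counted₃ z z≢rx z%h attached uncounted =
      block-counted z (trans (cong (_% h) (sym (deact-depth z))) z%h) (λ e → attached (trans (deact-parent z) e))
        (trans (sym (upd-≢ (cnt s) _ _ (λ z≡rx → z≢rx (trans z≡rx (sym (deact-rep x)))))) (trans (sym (deact-cnt z)) uncounted))

    invariant-before-queue : ∀ c → (cnt s₃ (rep s₃ x) ≡ᵇ 0) ≡ c →
      Invariant r′ L (if c then cutParent (rep s₃ x) s₃ else s₃)
    invariant-before-queue false counted = record
      { coupled = coupled₃ ; queue-sound = queue-sound₃ ; garbage-queued = garbage-queued₃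
      ; block-counted = λ z → counted-at (z ≟ rep s₃ x) }
      where
      counted-at : ∀ {z} → Dec (z ≡ rep s₃ x) → BlockCounted s₃ z
      counted-at {z} (no z≢rx) = block-counted₃ z z≢rx
      counted-at (yes refl) _ _ uncounted = contradiction (trans (sym counted) (cong (_≡ᵇ 0) uncounted)) (λ ())
    invariant-before-queue true uncounted = record
      { coupled = C.coupled′ ; queue-sound = C.queue-sound′ queue-sound₃
      ; block-counted = λ z → C.block-counted′ z (block-counted₃ z)
      ; garbage-queued = λ z → C.garbage-queued′ z (garbage-queued₃ z) }
      where
      root : BlockRootOf r′ s₃ (rep s₃ x) x
      root = Coupled.rep-block-root coupled₃ x ix
      module C = Cut coupled₃ (cutParent-spec (rep s₃ x) s₃)
                     (uncounted-block-detachable coupled₃ (proj₂ (proj₂ (proj₂ root))) (proj₁ (proj₂ root)) (≡ᵇ-true⇒≡ uncounted))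

  deactivate-preserves : ∀ {r L s x} → Invariant r L s → act r x ≡ true →
    Invariant (refStep r (deactivate x)) L (algDeactivate x s)
  deactivate-preserves {s = s} {x} inv ax =
    processQueue-preserves (Deactivate.invariant-before-queue inv ax (markInactive-spec x s _ refl) _ refl)

  newRep : ℕ → ℕ → AlgState → ℕ
  newRep x y s = if suc (depth s x) % h ≡ᵇ 0 then y else rep s x

  newRep-cases : ∀ x y s → newRep x y s ≡ y × suc (depth s x) % h ≡ 0
                         ⊎ newRep x y s ≡ rep s x × suc (depth s x) % h ≢ 0
  newRep-cases x y s with suc (depth s x) % h ≡ᵇ 0 in boundary
  ... | true  = inj₁ (refl , ≡ᵇ-true⇒≡ boundary)
  ... | false = inj₂ (refl , λ e → contradiction (trans (sym boundary) (cong (_≡ᵇ 0) e)) (λ ()))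

  record AddSpec (x y : ℕ) (s s′ : AlgState) : Set where
    field
      add-alloc    : ∀ z → alloc s′ z ≡ upd (alloc s) y true z
      add-active   : ∀ z → active s′ z ≡ upd (active s) y true z
      add-parent   : ∀ z → parent s′ z ≡ upd (parent s) y (just x) z
      add-children : ∀ z → children s′ z ≡ upd (upd (children s) x (suc (children s x))) y 0 z
      add-depth    : ∀ z → depth s′ z ≡ upd (depth s) y (suc (depth s x)) z
      add-rep      : ∀ z → rep s′ z ≡ upd (rep s) y (newRep x y s) z
      add-cnt      : ∀ z → cnt s′ z ≡ upd (upd (cnt s) y 0) (newRep x y s) (suc (upd (cnt s) y 0 (newRep x y s))) z
      add-queue    : queue s′ ≡ queue s

  attachChild : ℕ → ℕ → AlgState → AlgState
  attachChild x y s =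
    let s₁ = record s { alloc = upd (alloc s) y true ; active = upd (active s) y true ; parent = upd (parent s) y (just x) }
        s₂ = record s₁ { children = upd (children s₁) x (suc (children s₁ x)) }
        s₃ = record s₂ { children = upd (children s₂) y 0 ; cnt = upd (cnt s₂) y 0
                       ; depth = upd (depth s₂) y (suc (depth s₂ x)) }
        s₄ = record s₃ { rep = upd (rep s₃) y (if depth s₃ y % h ≡ᵇ 0 then y else rep s₃ x) }
    in record s₄ { cnt = upd (cnt s₄) (rep s₄ y) (suc (cnt s₄ (rep s₄ y))) }

  algAddChild-unfold : ∀ x y s → algAddChild h x y s ≡ processQueue (attachChild x y s)
  algAddChild-unfold x y s = refl

  attachChild-spec : ∀ x y s → AddSpec x y s (attachChild x y s)
  attachChild-spec x y s = record
    { add-alloc = λ _ → refl ; add-active = λ _ → refl ; add-parent = λ _ → refl ; add-children = λ _ → refl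
    ; add-depth = λ _ → refl
    ; add-rep = λ z → cong (λ d → upd (rep s) y (if d % h ≡ᵇ 0 then y else rep s x) z) (upd-≡ (depth s) y _)
    ; add-cnt = λ z → cong (λ b → upd (upd (cnt s) y 0) b (suc (upd (cnt s) y 0 b)) z) rep-y
    ; add-queue = refl }
    where
    rep-y : upd (rep s) y (if upd (depth s) y (suc (depth s x)) y % h ≡ᵇ 0 then y else rep s x) y ≡ newRep x y s
    rep-y = trans (upd-≡ (rep s) y _) (cong (λ d → if d % h ≡ᵇ 0 then y else rep s x) (upd-≡ (depth s) y _))

  module Add {r L s x y s₅} (inv : Invariant r L s) (ax : act r x ≡ true) (fresh : inT r y ≡ false)
             (spec : AddSpec x y s s₅) where
    open Invariant inv
    open Coupled coupled
    open AddSpec spec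

    r′ : RefState
    r′ = refStep r (addChild x y)

    inT⇒≢y : ∀ {z} → inT r z ≡ true → z ≢ y
    inT⇒≢y iz refl = contradiction (trans (sym iz) fresh) (λ ())

    ix : inT r x ≡ true
    ix = act⇒inT x ax

    x≢y : x ≢ y
    x≢y = inT⇒≢y ix

    inT⁺ : ∀ {z} → inT r z ≡ true → inT r′ z ≡ true
    inT⁺ iz = trans (upd-≢ (inT r) y true (inT⇒≢y iz)) iz

    inT⁻ : ∀ {z} → inT r′ z ≡ true → z ≢ y → inT r z ≡ true
    inT⁻ e z≢y = trans (sym (upd-≢ (inT r) y true z≢y)) e

    module T = Transfer r r′ edge⇒inT (λ z iz → upd-≢ (par r) y (just x) (inT⇒≢y iz))

    y→x : par r′ y ≡ just x
    y→x = upd-≡ (par r) y (just x)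

    ρ : ℕ
    ρ = newRep x y s

    children⁺ : ℕ → ℕ
    children⁺ = upd (children s) x (suc (children s x))

    depth-y : depth s₅ y ≡ suc (depth s x)
    depth-y = trans (add-depth y) (upd-≡ (depth s) y _)

    depth-old : ∀ {z} → z ≢ y → depth s₅ z ≡ depth s z
    depth-old z≢y = trans (add-depth _) (upd-≢ (depth s) y _ z≢y)

    cnt-y : cnt s y ≡ 0
    cnt-y = trans (cnt≡count y) (countᵇ-≡0 _ L not-rep-y)
      where
      not-rep-y : ∀ c → c ∈ L → (active s c ∧ (rep s c ≡ᵇ y)) ≡ false
      not-rep-y c m with active s c
      ... | false = refl
      ... | true  = ≢⇒≡ᵇ-false (inT⇒≢y (proj₂ (proj₂ (proj₂ (rep-block-root c (nodes⇒inT c m))))))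

    cnt₅ : ∀ z → cnt s₅ z ≡ upd (cnt s) ρ (suc (cnt s ρ)) z
    cnt₅ z = trans (add-cnt z) (cong₂ (λ a b → if z ≡ᵇ ρ then suc a else b) (reset-y ρ) (reset-y z))
      where
      reset-y : ∀ z → upd (cnt s) y 0 z ≡ cnt s z
      reset-y z with z ≟ y
      ... | yes refl = trans (upd-≡ (cnt s) y 0) (sym cnt-y)
      ... | no z≢y   = upd-≢ (cnt s) y 0 z≢y

    -- A witness y can be replaced by its parent x, which is at most one level shallower.
    Recent′⇒Recent : ∀ {z} → inT r z ≡ true → Recent h r′ z → Recent h r z
    Recent′⇒Recent {z} iz (_ , w , aw′ , zw , dz , dw , Dz , Dw , lw) with w ≟ y
    ... | yes refl with d′ , refl , Dx ← Tree.Depth-parent r′ y→x Dw =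
      iz , x , ax , T.Anc⁻ (Tree.Anc-parent r′ zw y→x (inT⇒≢y iz)) ix ,
      dz , d′ , T.Depth⁻ Dz iz , T.Depth⁻ Dx ix , ≤-trans (/-monoˡ-≤ h (n≤1+n d′)) lw
    ... | no w≢y = iz , w , aw , T.Anc⁻ zw iw , dz , dw , T.Depth⁻ Dz iz , T.Depth⁻ Dw iw , lw
      where
      aw = trans (sym (upd-≢ (act r) y true w≢y)) aw′
      iw = act⇒inT w aw

    children≡count₅ : ∀ x′ → children s₅ x′ ≡ countᵇ (λ c → isParentOf (parent s₅ c) x′) (y ∷ L)
    children≡count₅ x′ = trans (by-node x′) (sym (cong₂ (λ b n → if b then suc n else n) parent-y old-count))
      where
      old-count : countᵇ (λ c → isParentOf (parent s₅ c) x′) L ≡ children s x′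
      old-count = trans (countᵇ-cong _ _ L (λ c m → cong (λ t → isParentOf t x′)
                    (trans (add-parent c) (upd-≢ (parent s) y (just x) (inT⇒≢y (nodes⇒inT c m))))))
                    (sym (children≡count x′))
      parent-y : isParentOf (parent s₅ y) x′ ≡ (x ≡ᵇ x′)
      parent-y = cong (λ t → isParentOf t x′) (trans (add-parent y) (upd-≡ (parent s) y (just x)))
      childless-y : children s y ≡ 0
      childless-y = trans (children≡count y) (countᵇ-≡0 _ L (λ c _ → isParentOf-false _ y
                      (λ e → inT⇒≢y (proj₂ (edge⇒inT c y (proj₁ (parent⇒edge c y e)))) refl)))
      by-node : ∀ x′ → children s₅ x′ ≡ (if x ≡ᵇ x′ then suc (children s x′) else children s x′)
      by-node x′ with x′ ≟ y
      ... | yes refl rewrite ≢⇒≡ᵇ-false x≢y = trans (add-children y) (trans (upd-≡ children⁺ y 0) (sym childless-y))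
      ... | no x′≢y with x′ ≟ x
      ...   | yes refl rewrite ≡ᵇ-refl x =
        trans (add-children x) (trans (upd-≢ children⁺ y 0 x≢y) (upd-≡ (children s) x _))
      ...   | no x′≢x rewrite ≢⇒≡ᵇ-false (λ x≡x′ → x′≢x (sym x≡x′)) =
        trans (add-children x′) (trans (upd-≢ children⁺ y 0 x′≢y) (upd-≢ (children s) x _ x′≢x))

    rep-block-root₅ : ∀ z → inT r′ z ≡ true → BlockRootOf r′ s₅ (rep s₅ z) z
    rep-block-root₅ z iz′ with z ≟ y
    ... | yes refl = subst (λ b → BlockRootOf r′ s₅ b y) (sym (trans (add-rep y) (upd-≡ (rep s) y ρ))) root-y
      where
      root-y : BlockRootOf r′ s₅ ρ y
      root-y with newRep-cases x y s
      ... | inj₁ (ρ≡y , y%h) rewrite ρ≡y = anc-refl , trans (cong (_% h) depth-y) y%h , refl , upd-≡ (inT r) y true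
      ... | inj₂ (ρ≡rx , y%h≢0) rewrite ρ≡rx with bx , b%h , lb , ib ← rep-block-root x ix =
        anc-step y→x (T.Anc⁺ bx) ,
        trans (cong (_% h) (depth-old (inT⇒≢y ib))) b%h ,
        trans (cong (_/ h) (depth-old (inT⇒≢y ib)))
              (trans lb (trans (sym (level-suc-interior (depth s x) y%h≢0)) (cong (_/ h) (sym depth-y)))) ,
        inT⁺ ib
    ... | no z≢y with bz , b%h , lb , ib ← rep-block-root z (inT⁻ iz′ z≢y) =
      subst (λ b → BlockRootOf r′ s₅ b z) (sym (trans (add-rep z) (upd-≢ (rep s) y ρ z≢y)))
        (T.Anc⁺ bz , trans (cong (_% h) (depth-old (inT⇒≢y ib))) b%h ,
         trans (cong (_/ h) (depth-old (inT⇒≢y ib))) (trans lb (cong (_/ h) (sym (depth-old z≢y)))) , inT⁺ ib)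

    cnt≡count₅ : ∀ b → cnt s₅ b ≡ countᵇ (λ c → active s₅ c ∧ (rep s₅ c ≡ᵇ b)) (y ∷ L)
    cnt≡count₅ b = trans (cnt₅ b) (sym (trans (cong₂ (λ t n → if t then suc n else n) counts-y old-count) (by-root b)))
      where
      old-count : countᵇ (λ c → active s₅ c ∧ (rep s₅ c ≡ᵇ b)) L ≡ cnt s b
      old-count = trans (countᵇ-cong _ _ L (λ c m → cong₂ (λ a t → a ∧ (t ≡ᵇ b))
                    (trans (add-active c) (upd-≢ (active s) y true (inT⇒≢y (nodes⇒inT c m))))
                    (trans (add-rep c) (upd-≢ (rep s) y ρ (inT⇒≢y (nodes⇒inT c m)))))) (sym (cnt≡count b))
      counts-y : (active s₅ y ∧ (rep s₅ y ≡ᵇ b)) ≡ (ρ ≡ᵇ b)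
      counts-y = cong₂ (λ a t → a ∧ (t ≡ᵇ b)) (trans (add-active y) (upd-≡ (active s) y true))
                                            (trans (add-rep y) (upd-≡ (rep s) y ρ))
      by-root : ∀ b → (if ρ ≡ᵇ b then suc (cnt s b) else cnt s b) ≡ upd (cnt s) ρ (suc (cnt s ρ)) b
      by-root b with b ≟ ρ
      ... | yes refl rewrite ≡ᵇ-refl b = refl
      ... | no b≢ρ rewrite ≢⇒≡ᵇ-false (λ ρ≡b → b≢ρ (sym ρ≡b)) = sym (upd-≢ (cnt s) ρ _ b≢ρ)

    recent-edge-kept₅ : ∀ c p → par r′ c ≡ just p → RecentThrough r′ s₅ p c → parent s₅ c ≡ just p
    recent-edge-kept₅ c p c→′p rec with c ≟ y
    ... | yes refl = trans (trans (add-parent y) (upd-≡ (parent s) y (just x))) (trans (sym y→x) c→′p)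
    ... | no c≢y = trans (trans (add-parent c) (upd-≢ (parent s) y (just x) c≢y)) (recent-edge-kept c p c→p (old rec))
      where
      c→p : par r c ≡ just p
      c→p = trans (sym (upd-≢ (par r) y (just x) c≢y)) c→′p
      depth-p : depth s₅ p ≡ depth s p
      depth-p = depth-old (inT⇒≢y (proj₂ (edge⇒inT c p c→p)))
      old : RecentThrough r′ s₅ p c → RecentThrough r s p c
      old (through {w} aw′ cw lw) with w ≟ y
      ... | yes refl = through ax (T.Anc⁻ (Tree.Anc-parent r′ cw y→x c≢y) ix)
                         (≤-trans (/-monoˡ-≤ h (n≤1+n (depth s x))) (subst₂ (λ a b → a / h ≤ suc (b / h)) depth-y depth-p lw))
      ... | no w≢y = through aw (T.Anc⁻ cw (act⇒inT w aw)) (subst₂ (λ a b → a / h ≤ suc (b / h)) (depth-old w≢y) depth-p lw)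
        where aw = trans (sym (upd-≢ (act r) y true w≢y)) aw′

    inT⇒nodes₅ : ∀ z → inT r′ z ≡ true → z ∈ y ∷ L
    inT⇒nodes₅ z e with z ≟ y
    ... | yes refl = here refl
    ... | no z≢y   = there (inT⇒nodes z (inT⁻ e z≢y))

    act⇒inT₅ : ∀ z → act r′ z ≡ true → inT r′ z ≡ true
    act⇒inT₅ z e with z ≟ y
    ... | yes refl = upd-≡ (inT r) y true
    ... | no z≢y   = inT⁺ (act⇒inT z (trans (sym (upd-≢ (act r) y true z≢y)) e))

    depth-correct₅ : ∀ z → inT r′ z ≡ true → Depth r′ z (depth s₅ z)
    depth-correct₅ z e with z ≟ y
    ... | yes refl = subst (Depth r′ y) (sym depth-y) (depth-step y→x (T.Depth⁺ (depth-correct x ix) ix))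
    ... | no z≢y   = subst (Depth r′ z) (sym (depth-old z≢y)) (T.Depth⁺ (depth-correct z (inT⁻ e z≢y)) (inT⁻ e z≢y))

    depth<size₅ : ∀ z → inT r′ z ≡ true → depth s₅ z < length (y ∷ L)
    depth<size₅ z e with z ≟ y
    ... | yes refl = subst (_< suc (length L)) (sym depth-y) (s≤s (depth<size x ix))
    ... | no z≢y   = subst (_< suc (length L)) (sym (depth-old z≢y)) (m<n⇒m<1+n (depth<size z (inT⁻ e z≢y)))

    alloc⇒inT₅ : ∀ z → alloc s₅ z ≡ true → inT r′ z ≡ true
    alloc⇒inT₅ z e with z ≟ y
    ... | yes refl = upd-≡ (inT r) y true
    ... | no z≢y   = inT⁺ (alloc⇒inT z (trans (sym (upd-≢ (alloc s) y true z≢y)) (trans (sym (add-alloc z)) e)))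

    unalloc⇒¬Recent₅ : ∀ z → inT r′ z ≡ true → alloc s₅ z ≡ false → ¬ Recent h r′ z
    unalloc⇒¬Recent₅ z e al with z ≟ y
    ... | yes refl = contradiction (trans (sym (trans (add-alloc y) (upd-≡ (alloc s) y true))) al) (λ ())
    ... | no z≢y   = unalloc⇒¬Recent z (inT⁻ e z≢y) (trans (sym (upd-≢ (alloc s) y true z≢y)) (trans (sym (add-alloc z)) al))
                     ∘ Recent′⇒Recent (inT⁻ e z≢y)

    edge⇒inT₅ : ∀ z p → par r′ z ≡ just p → inT r′ z ≡ true × inT r′ p ≡ true
    edge⇒inT₅ z p e with z ≟ y
    ... | yes refl = upd-≡ (inT r) y true , subst (λ t → inT r′ t ≡ true) (just-injective (trans (sym y→x) e)) (inT⁺ ix)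
    ... | no z≢y with iz , ip ← edge⇒inT z p (trans (sym (upd-≢ (par r) y (just x) z≢y)) e) = inT⁺ iz , inT⁺ ip

    parent⇒edge₅ : ∀ z p → parent s₅ z ≡ just p → par r′ z ≡ just p × alloc s₅ z ≡ true
    parent⇒edge₅ z p e with z ≟ y
    ... | yes refl = trans y→x (trans (sym (trans (add-parent y) (upd-≡ (parent s) y (just x)))) e) ,
                     trans (add-alloc y) (upd-≡ (alloc s) y true)
    ... | no z≢y with z→p , az ← parent⇒edge z p (trans (sym (trans (add-parent z) (upd-≢ (parent s) y (just x) z≢y))) e) =
      trans (upd-≢ (par r) y (just x) z≢y) z→p , trans (add-alloc z) (trans (upd-≢ (alloc s) y true z≢y) az)

    coupled₅ : Coupled r′ (y ∷ L) s₅
    coupled₅ = record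
      { nodes⇒inT = λ { z (here refl) → upd-≡ (inT r) y true ; z (there m) → inT⁺ (nodes⇒inT z m) }
      ; inT⇒nodes = inT⇒nodes₅
      ; nodes-unique = All.tabulate (λ m y≡c → inT⇒≢y (nodes⇒inT _ m) (sym y≡c)) ∷ nodes-unique
      ; act⇒inT = act⇒inT₅
      ; edge⇒inT = edge⇒inT₅
      ; depth-correct = depth-correct₅
      ; depth<size = depth<size₅
      ; alloc⇒inT = alloc⇒inT₅
      ; active≡act = λ z → trans (add-active z) (cong (λ b → if z ≡ᵇ y then true else b) (active≡act z))
      ; parent⇒edge = parent⇒edge₅
      ; children≡count = children≡count₅
      ; rep-block-root = rep-block-root₅
      ; cnt≡count = cnt≡count₅
      ; recent-edge-kept = recent-edge-kept₅
      ; unalloc⇒¬Recent = unalloc⇒¬Recent₅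
      }

    queue-sound₅ : QueueSound r′ s₅
    queue-sound₅ q m with iq , q¬recent ← queue-sound q (subst (q ∈_) add-queue m) = inT⁺ iq , q¬recent ∘ Recent′⇒Recent iq

    block-counted₅ : ∀ z → BlockCounted s₅ z
    block-counted₅ z z%h attached uncounted with z ≟ ρ
    ... | yes refl = contradiction (trans (sym (cnt₅ z)) uncounted) (λ e → 1+n≢0 (trans (sym (upd-≡ (cnt s) z _)) e))
    ... | no z≢ρ with z ≟ y
    ...   | yes refl with newRep-cases x y s
    ...     | inj₁ (ρ≡y , _)    = z≢ρ (sym ρ≡y)
    ...     | inj₂ (_ , y%h≢0) = y%h≢0 (trans (cong (_% h) (sym depth-y)) z%h)
    block-counted₅ z z%h attached uncounted | no z≢ρ | no z≢y =
      block-counted z (trans (cong (_% h) (sym (depth-old z≢y))) z%h)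
        (λ e → attached (trans (add-parent z) (trans (upd-≢ (parent s) y (just x) z≢y) e)))
        (trans (sym (upd-≢ (cnt s) ρ _ z≢ρ)) (trans (sym (cnt₅ z)) uncounted))

    garbage-queued₅ : ∀ z → GarbageQueued s₅ z
    garbage-queued₅ z az inactive childless with z ≟ y
    ... | yes refl = contradiction (trans (sym (trans (add-active y) (upd-≡ (active s) y true))) inactive) (λ ())
    ... | no z≢y with z ≟ x
    ...   | yes refl = contradiction (trans (sym (trans (add-children x) (trans (upd-≢ children⁺ y 0 x≢y) (upd-≡ (children s) x _)))) childless) (λ ())
    ...   | no z≢x = subst (z ∈_) (sym add-queue) (garbage-queued z
                (trans (sym (upd-≢ (alloc s) y true z≢y)) (trans (sym (add-alloc z)) az))
                (trans (sym (upd-≢ (active s) y true z≢y)) (trans (sym (add-active z)) inactive))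
                (trans (sym (upd-≢ (children s) x _ z≢x)) (trans (sym (upd-≢ children⁺ y 0 z≢y)) (trans (sym (add-children z)) childless))))

    invariant-before-queue : Invariant r′ (y ∷ L) s₅
    invariant-before-queue = record
      { coupled = coupled₅ ; queue-sound = queue-sound₅ ; block-counted = block-counted₅ ; garbage-queued = garbage-queued₅ }

  addChild-preserves : ∀ {r L s x y} → Invariant r L s → act r x ≡ true → inT r y ≡ false →
    Invariant (refStep r (addChild x y)) (y ∷ L) (algAddChild h x y s)
  addChild-preserves {r} {L} {s} {x} {y} inv ax fresh =
    subst (Invariant (refStep r (addChild x y)) (y ∷ L)) (sym (algAddChild-unfold x y s))
      (processQueue-preserves (Add.invariant-before-queue inv ax fresh (attachChild-spec x y s)))

  init-invariant : ∀ x₀ → Invariant (refInit x₀) [ x₀ ] (algInit x₀)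
  init-invariant x₀ = record
    { coupled = record
      { nodes⇒inT = λ { z (here refl) → ≡ᵇ-refl z }
      ; inT⇒nodes = λ z e → here (≡ᵇ-true⇒≡ e)
      ; nodes-unique = [] ∷ []
      ; act⇒inT = λ _ e → e
      ; edge⇒inT = λ _ _ ()
      ; depth-correct = λ _ _ → depth-root refl
      ; depth<size = λ _ _ → s≤s z≤n
      ; alloc⇒inT = λ _ e → e
      ; active≡act = λ _ → refl
      ; parent⇒edge = λ _ _ ()
      ; children≡count = λ _ → refl
      ; rep-block-root = rep-block-root₀
      ; cnt≡count = cnt≡count₀
      ; recent-edge-kept = λ _ _ ()
      ; unalloc⇒¬Recent = λ _ iz al → contradiction (trans (sym iz) al) (λ ())
      }
    ; queue-sound = λ _ ()
    ; block-counted = λ _ _ detached → contradiction refl detached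
    ; garbage-queued = λ _ az inactive → contradiction (trans (sym az) inactive) (λ ())
    }
    where
    r₀ = refInit x₀
    s₀ = algInit x₀
    rep-block-root₀ : ∀ z → inT r₀ z ≡ true → BlockRootOf r₀ s₀ (rep s₀ z) z
    rep-block-root₀ z e with refl ← ≡ᵇ-true⇒≡ {z} {x₀} e =
      subst (λ b → BlockRootOf r₀ s₀ b z) (sym (upd-≡ (λ z → z) z z)) (anc-refl , m*n%n≡0 0 h , refl , e)
    cnt≡count₀ : ∀ b → cnt s₀ b ≡ countᵇ (λ c → active s₀ c ∧ (rep s₀ c ≡ᵇ b)) [ x₀ ]
    cnt≡count₀ b with b ≟ x₀
    ... | yes refl rewrite ≡ᵇ-refl b = cong (λ t → if t then 1 else 0) (sym (≡ᵇ-refl b))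
    ... | no b≢x₀ rewrite ≡ᵇ-refl x₀ | ≢⇒≡ᵇ-false b≢x₀ | ≢⇒≡ᵇ-false (λ x₀≡b → b≢x₀ (sym x₀≡b)) = refl

  run-preserves : ∀ {r L s} ops → Invariant r L s → Valid r ops →
    ∃ λ L′ → Invariant (refRun r ops) L′ (algRun h s ops)
  run-preserves []                     inv _                  = _ , inv
  run-preserves (addChild x y ∷ ops) inv ((ax , fresh) , valid) = run-preserves ops (addChild-preserves inv ax fresh) valid
  run-preserves (deactivate x ∷ ops) inv (ax , valid)          = run-preserves ops (deactivate-preserves inv ax) valid

  Recent⇒alloc : ∀ {r L s} → Invariant r L s → ∀ x → Recent h r x → alloc s x ≡ true
  Recent⇒alloc {s = s} inv x rec with alloc s x in e
  ... | true  = refl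
  ... | false = contradiction rec (Coupled.unalloc⇒¬Recent (Invariant.coupled inv) x (proj₁ rec) e)

  -- Walk down from x along allocated children of the same level; depths are bounded by |T|, so the walk
  -- ends at a node that is either garbage (hence queued) or has a child opening a new block, whose
  -- positive count yields an active node making x recent.
  ¬Recent⇒queue≢[] : ∀ {r L s} → Invariant r L s → ∀ x → alloc s x ≡ true → ¬ Recent h r x → queue s ≢ []
  ¬Recent⇒queue≢[] {r} {L} {s} inv x₀ ax₀ x₀¬recent queue≡[] = descend (length L) x₀ ax₀ x₀¬recent (m≤n+m _ _)
    where
    open Invariant inv
    open Coupled coupled
    open Tree r

    descend : ∀ n x → alloc s x ≡ true → ¬ Recent h r x → length L ≤ depth s x + n → ⊥
    descend n x az x¬recent bound = via-child
      where
      ix : inT r x ≡ true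
      ix = alloc⇒inT x az

      recent-via : ∀ {c w} → par r c ≡ just x → act r w ≡ true → Anc r c w → depth s w / h ≤ suc (depth s x / h) → ⊥
      recent-via c→x aw cw lw = x¬recent (RecentThrough⇒Recent coupled ix (through aw (Anc-trans (anc-step c→x anc-refl) cw) lw))

      recent-via-block : ∀ {c w} → par r c ≡ just x → depth s c % h ≡ 0 → act r w ≡ true → rep s w ≡ c → ⊥
      recent-via-block {w = w} c→x c%h aw refl with cw , _ , lw , _ ← rep-block-root w (act⇒inT w aw) =
        recent-via c→x aw cw (≤-reflexive (trans (sym lw) (level-child coupled c→x c%h)))

      inactive : active s x ≡ false
      inactive with active s x in e
      ... | false = refl
      ... | true  = contradiction (RecentThrough⇒Recent coupled ix
                      (through (trans (sym (active≡act x)) e) anc-refl (n≤1+n _))) x¬recent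

      has-children : countᵇ (λ c → isParentOf (parent s c) x) L ≢ 0
      has-children childless with () ← subst (x ∈_) queue≡[]
        (garbage-queued x az inactive (trans (children≡count x) childless))

      via-child : ⊥
      via-child with c , _ , c↦x ← countᵇ-witness _ L has-children
                with c→x , ac ← parent⇒edge c x (isParentOf-true _ x c↦x)
                with depth s c % h ≟ 0
      ... | yes c%h with w , _ , counted ← countᵇ-witness _ L (subst (_≢ 0) (cnt≡count c)
                           (block-counted c c%h (λ e → contradiction (trans (sym e) (isParentOf-true _ x c↦x)) (λ ()))))
                    with aw , rw≡c ← ∧≡true⇒ counted =
        recent-via-block c→x c%h (trans (sym (active≡act w)) aw) (≡ᵇ-true⇒≡ rw≡c)
      ... | no c%h≢0 = continue n bound
        where
        same-level : depth s c / h ≡ depth s x / h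
        same-level = trans (cong (_/ h) (depth-child coupled c→x))
                           (level-suc-interior (depth s x) (λ e → c%h≢0 (trans (cong (_% h) (depth-child coupled c→x)) e)))
        c¬recent : ¬ Recent h r c
        c¬recent rec with through aw cw lw ← Recent⇒RecentThrough coupled rec =
          recent-via c→x aw cw (subst (λ l → _ ≤ suc l) same-level lw)
        continue : ∀ n → length L ≤ depth s x + n → ⊥
        continue zero    bound = <-irrefl refl (<-≤-trans (depth<size x ix) (subst (length L ≤_) (+-identityʳ _) bound))
        continue (suc n) bound = descend n c ac c¬recent
          (subst (length L ≤_) (trans (+-suc _ n) (cong (_+ n) (sym (depth-child coupled c→x)))) bound)

lemma6 : (h : ℕ) → .{{_ : NonZero h}} → (x₀ : ℕ) → (ops : List Op) →
    Valid (refInit x₀) ops →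
    (k : ℕ) → k ≤ length ops →
    ((x : ℕ) → Recent h (refRun (refInit x₀) (take k ops)) x →
       alloc (algRun h (algInit x₀) (take k ops)) x ≡ true)
    ×
    ((∃ λ x → (alloc (algRun h (algInit x₀) (take k ops)) x ≡ true)
              × ¬ Recent h (refRun (refInit x₀) (take k ops)) x) →
       queue (algRun h (algInit x₀) (take k ops)) ≢ [])
lemma6 h x₀ ops valid k _ =
  Recent⇒alloc inv , λ (x , ax , x¬recent) → ¬Recent⇒queue≢[] inv x ax x¬recent
  where
  open Invariants h
  inv = proj₂ (run-preserves (take k ops) (init-invariant x₀) (Valid-take k ops valid))
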